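{- Let $n\geqslant 2$ and $m\geqslant 1$ be integers, and let $P_{n-1}$ denote the path graph on $n-1$ vertices. The number $p(2m)$ of closed walks of length $2m$ on $P_{n-1}$ is $$p(2m)=\begin{cases}\displaystyle 2n\Bigl(\binom{2m-1}{m-1}+\sum_{k=1}^{\lfloor m/n\rfloor}\binom{2m}{m-kn}\Bigr)-2^{2m}, & m\geqslant n,\\[2mm] \displaystyle 2n\binom{2m-1}{m-1}-2^{2m}, & m<n.\end{cases}$$
   Context: A walk of length $r$ in a graph is a sequence $(v_0,v_1,\dots,v_r)$ of vertices (not necessarily distinct) such that $v_{i-1}$ and $v_i$ are adjacent for each $i=1,\dots,r$; it is closed if $v_0=v_r$. The number of closed walks of length $r$ is the number of such sequences, i.e. the trace of $A^r$ where $A$ is the adjacency matrix. The path graph $P_{n-1}$ has vertices $1,\dots,n-1$ with $i$ adjacent to $j$ iff $|i-j|=1$. $\lfloor x\rfloor$ is the floor of $x$. -}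

module Defs where

open import Data.Nat using (ℕ; zero; suc; _+_; _*_; _∸_)
open import Data.Nat.Properties using (_≟_)
open import Data.Fin using (Fin; toℕ)
open import Data.Bool using (Bool; true; false; _∨_)
open import Relation.Nullary.Decidable using (⌊_⌋)

∑ : (k : ℕ) → (Fin k → ℕ) → ℕ
∑ zero    f = 0
∑ (suc k) f = f Fin.zero + ∑ k (λ i → f (Fin.suc i))

-- Path graph P_k on vertices 0..k-1 (i.e. 1..k shifted), i ~ j iff |i-j| = 1
pathAdj : (k : ℕ) → Fin k → Fin k → ℕ
pathAdj k i j with ⌊ suc (toℕ i) ≟ toℕ j ⌋ ∨ ⌊ suc (toℕ j) ≟ toℕ i ⌋
... | true  = 1
... | false = 0

identity : (k : ℕ) → Fin k → Fin k → ℕ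
identity k i j with ⌊ toℕ i ≟ toℕ j ⌋
... | true  = 1
... | false = 0

-- Matrix power: (A^r)_{ij} for the adjacency matrix A of P_k
-- (equivalently, the number of walks of length r from i to j)
adjPow : (k : ℕ) → ℕ → Fin k → Fin k → ℕ
adjPow k zero    i j = identity k i j
adjPow k (suc r) i j = ∑ k (λ l → pathAdj k i l * adjPow k r l j)

closedWalks : (k : ℕ) → ℕ → ℕ
closedWalks k r = ∑ k (λ i → adjPow k r i i)

open import Data.Nat using (_≤_; NonZero; >-nonZero; s≤s; z≤n)
open import Data.Nat.Properties using (≤-trans)
open import Data.Nat.Combinatorics using (_C_)

≥2⇒nonZero : ∀ {n} → 2 ≤ n → NonZero n
≥2⇒nonZero h = >-nonZero (≤-trans (s≤s z≤n) h)

-- ∑_{k=1}^{K} binom(2m, m - k n)   (here K will be ⌊m/n⌋, so m - k n ≥ 0)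
sumBinoms : (n m K : ℕ) → ℕ
sumBinoms n m zero    = 0
sumBinoms n m (suc K) = sumBinoms n m K + ((2 * m) C (m ∸ (suc K * n)))

{-# OPTIONS --safe #-}
module Submission where

-- Put the path on k = n − 1 vertices into the cycle of length 2n, between two mirrors.  By the
-- reflection principle the walks x → y of length r on the path are the cycle walks x → y minus the
-- cycle walks from x to the mirror image of y.  Writing c(d) for the number of ±1-sequences of
-- length r with sum ≡ d (mod 2n), summing over x gives  #closed walks = (n − 1)·c(0) − Σ_{x=1}^{n−1} c(2x).
-- For r = 2m only even sums occur, so Σ_{x=0}^{n−1} c(2x) = 4^m and  #closed walks + 4^m = n·c(0).
-- Finally c(0) = Σ_{2n ∣ 2j − 2m} C(2m, j); pairing j = m ± t, where n ∣ t, and C(2m, m) = 2·C(2m−1, m−1)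
-- give c(0) = 2·(C(2m−1, m−1) + Σ_{i≥1} C(2m, m − in)).

module ClosedWalkCount where

  open import Defs
  open import Data.Nat
    using (ℕ; zero; suc; pred; z<s; s≤s; s≤s⁻¹; _+_; _*_; _∸_; _^_; _/_; _≤_; _<_; _≟_; _<?_; _≤?_; NonZero; >-nonZero⁻¹)
  open import Data.Nat.Properties
  open import Data.Nat.Combinatorics using (_C_; nCk+nC[k+1]≡[n+1]C[k+1]; k>n⇒nCk≡0; nCk≡nC[n∸k])
  open import Data.Nat.Divisibility
    using (_∣_; _∣?_; divides; ∣-refl; _∣0; ∣⇒≤; ∣m∣n⇒∣m+n; ∣m+n∣m⇒∣n; *-monoʳ-∣; *-cancelˡ-∣)
  open import Data.Nat.DivMod using (m/n*n≤m; m%n<n; m≡m%n+[m/n]*n)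
  open import Data.Nat.Tactic.RingSolver using (solve-∀)
  open import Algebra.Properties.CommutativeSemigroup +-commutativeSemigroup
    using (interchange; x∙yz≈y∙xz; xy∙z≈xz∙y)
  import Data.Integer as ℤ
  open import Data.Integer.Properties using ([+m]-[+n]≡m⊖n; ⊖-≥)
  open import Data.Fin using (Fin; toℕ)
  open import Data.Fin.Properties using (toℕ<n)
  open import Data.Bool using (if_then_else_)
  open import Function using (_∘_)
  open import Relation.Nullary using (Dec; yes; no; does; ¬_; contradiction)
  open import Relation.Nullary.Decidable using (dec-true; dec-false)
  open import Relation.Binary.PropositionalEquality

  𝟙 : ∀ {p} {P : Set p} → Dec P → ℕ
  𝟙 p? = if does p? then 1 else 0

  𝟙-yes : ∀ {p} {P : Set p} (p? : Dec P) → P → 𝟙 p? ≡ 1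
  𝟙-yes p? x rewrite dec-true p? x = refl

  𝟙-no : ∀ {p} {P : Set p} (p? : Dec P) → ¬ P → 𝟙 p? ≡ 0
  𝟙-no p? ¬x rewrite dec-false p? ¬x = refl

  𝟙-cong : ∀ {p q} {P : Set p} {Q : Set q} (p? : Dec P) (q? : Dec Q) → (P → Q) → (Q → P) → 𝟙 p? ≡ 𝟙 q?
  𝟙-cong (yes x) q? P⇒Q Q⇒P = sym (𝟙-yes q? (P⇒Q x))
  𝟙-cong (no ¬x) q? P⇒Q Q⇒P = sym (𝟙-no q? (¬x ∘ Q⇒P))

  𝟙∣-+ : ∀ d a {b} → d ∣ b → 𝟙 (d ∣? a + b) ≡ 𝟙 (d ∣? a)
  𝟙∣-+ d a {b} d∣b = 𝟙-cong (d ∣? a + b) (d ∣? a)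
    (λ d∣a+b → ∣m+n∣m⇒∣n (subst (d ∣_) (+-comm a b) d∣a+b) d∣b)
    (λ d∣a → ∣m∣n⇒∣m+n d∣a d∣b)

  𝟙∣-complement : ∀ d a b → d ∣ a + b → 𝟙 (d ∣? a) ≡ 𝟙 (d ∣? b)
  𝟙∣-complement d a b d∣a+b = 𝟙-cong (d ∣? a) (d ∣? b)
    (∣m+n∣m⇒∣n d∣a+b)
    (∣m+n∣m⇒∣n (subst (d ∣_) (+-comm a b) d∣a+b))

  𝟙∣-double : ∀ n a → 𝟙 (2 * n ∣? a + a) ≡ 𝟙 (n ∣? a)
  𝟙∣-double n a = 𝟙-cong (2 * n ∣? a + a) (n ∣? a)
    (λ 2n∣a+a → *-cancelˡ-∣ 2 (subst (2 * n ∣_) (a+a≡2a a) 2n∣a+a))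
    (λ n∣a → subst (2 * n ∣_) (sym (a+a≡2a a)) (*-monoʳ-∣ 2 n∣a))
    where
    a+a≡2a : ∀ a → a + a ≡ 2 * a
    a+a≡2a = solve-∀

  0<a<d⇒d∤a : ∀ {d a} → 0 < a → a < d → ¬ d ∣ a
  0<a<d⇒d∤a {d} {suc a} _ a<d d∣a = <⇒≱ a<d (∣⇒≤ d∣a)

  qd<a<[1+q]d⇒d∤a : ∀ {d a} q → q * d < a → a < suc q * d → ¬ d ∣ a
  qd<a<[1+q]d⇒d∤a {d} q qd<a a<[1+q]d (divides p refl) =
    <⇒≱ (*-cancelʳ-< d q p qd<a) (s≤s⁻¹ (*-cancelʳ-< d p (suc q) a<[1+q]d))

  d∣a∧0<a<2d⇒a≡d : ∀ {d a} → d ∣ a → 0 < a → a < d + d → a ≡ d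
  d∣a∧0<a<2d⇒a≡d {d} (divides (suc zero) refl) _ _ = +-identityʳ d
  d∣a∧0<a<2d⇒a≡d {d} (divides (suc (suc q)) refl) _ a<2d =
    contradiction a<2d (≤⇒≯ (+-monoʳ-≤ d (m≤m+n d (q * d))))

  m<[1+m/n]*n : ∀ m n .{{_ : NonZero n}} → m < suc (m / n) * n
  m<[1+m/n]*n m n = subst (_< suc (m / n) * n) (sym (m≡m%n+[m/n]*n m n)) (+-monoˡ-< (m / n * n) (m%n<n m n))

  Σ< : ℕ → (ℕ → ℕ) → ℕ
  Σ< zero    f = 0
  Σ< (suc k) f = Σ< k f + f k

  syntax Σ< k (λ x → e) = Σ[ x < k ] e

  Σ-cong : ∀ k {f g : ℕ → ℕ} → (∀ x → x < k → f x ≡ g x) → Σ< k f ≡ Σ< k g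
  Σ-cong zero    f≗g = refl
  Σ-cong (suc k) f≗g = cong₂ _+_ (Σ-cong k (λ x x<k → f≗g x (m<n⇒m<1+n x<k))) (f≗g k ≤-refl)

  Σ-suc : ∀ k (f : ℕ → ℕ) → Σ< (suc k) f ≡ f 0 + Σ[ x < k ] f (suc x)
  Σ-suc zero    f = +-comm 0 (f 0)
  Σ-suc (suc k) f = trans (cong (_+ f (suc k)) (Σ-suc k f)) (+-assoc (f 0) _ _)

  Σ-distrib-+ : ∀ k (f g : ℕ → ℕ) → Σ[ x < k ] (f x + g x) ≡ Σ< k f + Σ< k g
  Σ-distrib-+ zero    f g = refl
  Σ-distrib-+ (suc k) f g =
    trans (cong (_+ (f k + g k)) (Σ-distrib-+ k f g)) (interchange (Σ< k f) (Σ< k g) (f k) (g k))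

  Σ-const : ∀ k c → Σ[ _ < k ] c ≡ k * c
  Σ-const zero    c = refl
  Σ-const (suc k) c = trans (cong (_+ c) (Σ-const k c)) (+-comm (k * c) c)

  Σ-split : ∀ a b (f : ℕ → ℕ) → Σ< (a + b) f ≡ Σ< a f + Σ[ y < b ] f (a + y)
  Σ-split zero    b f = refl
  Σ-split (suc a) b f = begin
    Σ< (suc (a + b)) f                                           ≡⟨ Σ-suc (a + b) f ⟩
    f 0 + Σ[ x < a + b ] f (suc x)                                ≡⟨ cong (f 0 +_) (Σ-split a b (f ∘ suc)) ⟩
    f 0 + (Σ[ x < a ] f (suc x) + Σ[ y < b ] f (suc a + y))       ≡⟨ +-assoc (f 0) _ _ ⟨
    (f 0 + Σ[ x < a ] f (suc x)) + Σ[ y < b ] f (suc a + y)       ≡⟨ cong (_+ Σ[ y < b ] f (suc a + y)) (Σ-suc a f) ⟨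
    Σ< (suc a) f + Σ[ y < b ] f (suc a + y)                       ∎
    where open ≡-Reasoning

  Σ-reverse : ∀ k (f : ℕ → ℕ) → Σ< k f ≡ Σ[ y < k ] f (k ∸ suc y)
  Σ-reverse zero    f = refl
  Σ-reverse (suc k) f =
    trans (cong (_+ f k) (Σ-reverse k f)) (trans (+-comm _ (f k)) (sym (Σ-suc k (λ y → f (suc k ∸ suc y)))))

  Σ-around : ∀ m (f : ℕ → ℕ) → Σ< (suc (2 * m)) f ≡ f m + Σ[ y < m ] (f (m ∸ suc y) + f (m + suc y))
  Σ-around m f = begin
    Σ< (suc (2 * m)) f                                                    ≡⟨ cong (λ t → Σ< t f) (1+2m≡m+[1+m] m) ⟩
    Σ< (m + suc m) f                                                      ≡⟨ Σ-split m (suc m) f ⟩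
    Σ< m f + Σ[ y < suc m ] f (m + y)                                     ≡⟨ cong₂ _+_ (Σ-reverse m f) (Σ-suc m (λ y → f (m + y))) ⟩
    Σ[ y < m ] f (m ∸ suc y) + (f (m + 0) + Σ[ y < m ] f (m + suc y))     ≡⟨ x∙yz≈y∙xz (Σ[ y < m ] f (m ∸ suc y)) (f (m + 0)) _ ⟩
    f (m + 0) + (Σ[ y < m ] f (m ∸ suc y) + Σ[ y < m ] f (m + suc y))     ≡⟨ cong₂ _+_ (cong f (sym (+-identityʳ m))) (Σ-distrib-+ m _ _) ⟨
    f m + Σ[ y < m ] (f (m ∸ suc y) + f (m + suc y))                      ∎
    where
    open ≡-Reasoning
    1+2m≡m+[1+m] : ∀ m → suc (2 * m) ≡ m + suc m
    1+2m≡m+[1+m] = solve-∀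

  Σ-select : ∀ k c (F : ℕ → ℕ) → Σ[ l < k ] (𝟙 (c ≟ l) * F l) ≡ 𝟙 (c <? k) * F c
  Σ-select zero    c F = refl
  Σ-select (suc k) c F with c ≟ k
  ... | yes refl = begin
    Σ[ l < k ] (𝟙 (k ≟ l) * F l) + 𝟙 (k ≟ k) * F k   ≡⟨ cong₂ (λ s i → s + i * F k) (Σ-select k k F) (𝟙-yes (k ≟ k) refl) ⟩
    𝟙 (k <? k) * F k + 1 * F k                         ≡⟨ cong (λ i → i * F k + 1 * F k) (𝟙-no (k <? k) (n≮n k)) ⟩
    1 * F k                                             ≡⟨ cong (_* F k) (𝟙-yes (k <? suc k) ≤-refl) ⟨
    𝟙 (k <? suc k) * F k                                ∎
    where open ≡-Reasoning
  ... | no c≢k = begin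
    Σ[ l < k ] (𝟙 (c ≟ l) * F l) + 𝟙 (c ≟ k) * F k   ≡⟨ cong₂ (λ s i → s + i * F k) (Σ-select k c F) (𝟙-no (c ≟ k) c≢k) ⟩
    𝟙 (c <? k) * F c + 0                               ≡⟨ +-identityʳ _ ⟩
    𝟙 (c <? k) * F c                                   ≡⟨ cong (_* F c) (𝟙-cong (c <? k) (c <? suc k) m<n⇒m<1+n c<1+k⇒c<k) ⟩
    𝟙 (c <? suc k) * F c                               ∎
    where
    open ≡-Reasoning
    c<1+k⇒c<k : c < suc k → c < k
    c<1+k⇒c<k c<1+k = ≤∧≢⇒< (s≤s⁻¹ c<1+k) c≢k

  Σ-predecessor : ∀ k x (F : ℕ → ℕ) → x < k → Σ[ l < k ] (𝟙 (suc l ≟ x) * F l) ≡ 𝟙 (0 <? x) * F (pred x)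
  Σ-predecessor k zero    F _   = trans (Σ-const k 0) (*-zeroʳ k)
  Σ-predecessor k (suc x) F x<k = begin
    Σ[ l < k ] (𝟙 (l ≟ x) * F l)    ≡⟨ Σ-cong k (λ l _ → cong (_* F l) (𝟙-cong (l ≟ x) (x ≟ l) sym sym)) ⟩
    Σ[ l < k ] (𝟙 (x ≟ l) * F l)    ≡⟨ Σ-select k x F ⟩
    𝟙 (x <? k) * F x               ≡⟨ cong (_* F x) (𝟙-yes (x <? k) (<-trans (n<1+n x) x<k)) ⟩
    1 * F x                        ∎
    where open ≡-Reasoning

  Σ-multiples : ∀ n .{{_ : NonZero n}} (f : ℕ → ℕ) M K → K * n ≤ M → M < suc K * n →
                Σ[ y < M ] (𝟙 (n ∣? suc y) * f (suc y)) ≡ Σ[ j < K ] f (suc j * n)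
  Σ-multiples n f zero    zero    _       _ = refl
  Σ-multiples n f zero    (suc K) [1+K]n≤0 _ = contradiction [1+K]n≤0 (<⇒≱ (<-≤-trans (>-nonZero⁻¹ n) (m≤m+n n (K * n))))
  Σ-multiples n f (suc M) K Kn≤1+M 1+M<[1+K]n with K * n ≤? M
  ... | yes Kn≤M = begin
    Σ[ y < M ] (𝟙 (n ∣? suc y) * f (suc y)) + 𝟙 (n ∣? suc M) * f (suc M)
      ≡⟨ cong₂ _+_ (Σ-multiples n f M K Kn≤M (<-trans (n<1+n M) 1+M<[1+K]n))
                   (cong (_* f (suc M)) (𝟙-no (n ∣? suc M) (qd<a<[1+q]d⇒d∤a K (s≤s Kn≤M) 1+M<[1+K]n))) ⟩
    Σ[ j < K ] f (suc j * n) + 0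
      ≡⟨ +-identityʳ _ ⟩
    Σ[ j < K ] f (suc j * n) ∎
    where open ≡-Reasoning
  ... | no Kn≰M = at-multiple K (≤-antisym Kn≤1+M (≰⇒> Kn≰M))
    where
    at-multiple : ∀ K → K * n ≡ suc M → Σ[ y < suc M ] (𝟙 (n ∣? suc y) * f (suc y)) ≡ Σ[ j < K ] f (suc j * n)
    at-multiple (suc K) [1+K]n≡1+M = cong₂ _+_
      (Σ-multiples n f M K (s≤s⁻¹ (subst (K * n <_) [1+K]n≡1+M (m<n+m (K * n) (>-nonZero⁻¹ n))))
                           (subst (M <_) (sym [1+K]n≡1+M) (n<1+n M)))
      (trans (cong (_* f (suc M)) (𝟙-yes (n ∣? suc M) (divides (suc K) (sym [1+K]n≡1+M))))
             (trans (*-identityˡ (f (suc M))) (cong f (sym [1+K]n≡1+M))))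

  ∑-toℕ : ∀ k {f : Fin k → ℕ} {g : ℕ → ℕ} → (∀ i → f i ≡ g (toℕ i)) → ∑ k f ≡ Σ< k g
  ∑-toℕ zero    f≗g = refl
  ∑-toℕ (suc k) {g = g} f≗g =
    trans (cong₂ _+_ (f≗g Fin.zero) (∑-toℕ k (f≗g ∘ Fin.suc))) (sym (Σ-suc k g))

  walks : (k r x y : ℕ) → ℕ
  walks k zero    x y = 𝟙 (x ≟ y)
  walks k (suc r) x y = 𝟙 (suc x <? k) * walks k r (suc x) y + 𝟙 (0 <? x) * walks k r (pred x) y

  pathAdj≡𝟙 : ∀ k (i l : Fin k) → pathAdj k i l ≡ 𝟙 (suc (toℕ i) ≟ toℕ l) + 𝟙 (suc (toℕ l) ≟ toℕ i)
  pathAdj≡𝟙 k i l with suc (toℕ i) ≟ toℕ l in eq₁ | suc (toℕ l) ≟ toℕ i in eq₂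
  ... | yes i<l | yes l<i = contradiction (≤-reflexive l<i) (<-asym (≤-reflexive i<l))
  ... | yes _   | no _    = cong₂ (λ d₁ d₂ → 𝟙 d₁ + 𝟙 d₂) (sym eq₁) (sym eq₂)
  ... | no _    | yes _   = cong₂ (λ d₁ d₂ → 𝟙 d₁ + 𝟙 d₂) (sym eq₁) (sym eq₂)
  ... | no _    | no _    = cong₂ (λ d₁ d₂ → 𝟙 d₁ + 𝟙 d₂) (sym eq₁) (sym eq₂)

  identity≡𝟙 : ∀ k (i j : Fin k) → identity k i j ≡ 𝟙 (toℕ i ≟ toℕ j)
  identity≡𝟙 k i j with toℕ i ≟ toℕ j in eq
  ... | yes _ = cong 𝟙 (sym eq)
  ... | no _  = cong 𝟙 (sym eq)

  adjPow≡walks : ∀ k r (i j : Fin k) → adjPow k r i j ≡ walks k r (toℕ i) (toℕ j)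
  adjPow≡walks k zero    i j = identity≡𝟙 k i j
  adjPow≡walks k (suc r) i j = begin
    adjPow k (suc r) i j
      ≡⟨ ∑-toℕ k (λ l → cong₂ _*_ (pathAdj≡𝟙 k i l) (adjPow≡walks k r l j)) ⟩
    Σ[ l < k ] ((𝟙 (suc x ≟ l) + 𝟙 (suc l ≟ x)) * W l)
      ≡⟨ Σ-cong k (λ l _ → *-distribʳ-+ (W l) (𝟙 (suc x ≟ l)) (𝟙 (suc l ≟ x))) ⟩
    Σ[ l < k ] (𝟙 (suc x ≟ l) * W l + 𝟙 (suc l ≟ x) * W l)
      ≡⟨ Σ-distrib-+ k (λ l → 𝟙 (suc x ≟ l) * W l) (λ l → 𝟙 (suc l ≟ x) * W l) ⟩
    Σ[ l < k ] (𝟙 (suc x ≟ l) * W l) + Σ[ l < k ] (𝟙 (suc l ≟ x) * W l)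
      ≡⟨ cong₂ _+_ (Σ-select k (suc x) W) (Σ-predecessor k x W (toℕ<n i)) ⟩
    walks k (suc r) x (toℕ j) ∎
    where
    open ≡-Reasoning
    x : ℕ
    x = toℕ i
    W : ℕ → ℕ
    W l = walks k r l (toℕ j)

  closedWalks≡Σwalks : ∀ k r → closedWalks k r ≡ Σ[ x < k ] walks k r x x
  closedWalks≡Σwalks k r = ∑-toℕ k (λ i → adjPow≡walks k r i i)

  centralBinomial : ∀ m → (2 * suc m) C suc m ≡ 2 * ((2 * suc m ∸ 1) C m)
  centralBinomial m = begin
    suc t C suc m           ≡⟨ nCk+nC[k+1]≡[n+1]C[k+1] t m ⟨
    t C m + t C suc m       ≡⟨ cong (t C m +_) (nCk≡nC[n∸k] (subst (suc m ≤_) (sym t≡1+m+m) (m≤m+n (suc m) m))) ⟩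
    t C m + t C (t ∸ suc m) ≡⟨ cong (λ i → t C m + t C i) (trans (cong (_∸ suc m) t≡1+m+m) (m+n∸m≡n (suc m) m)) ⟩
    t C m + t C m           ≡⟨ cong (t C m +_) (+-identityʳ (t C m)) ⟨
    2 * (t C m)             ∎
    where
    open ≡-Reasoning
    t : ℕ
    t = 2 * suc m ∸ 1
    m+[1+m+0]≡1+m+m : ∀ m → m + suc (m + 0) ≡ suc m + m
    m+[1+m+0]≡1+m+m = solve-∀
    t≡1+m+m : t ≡ suc m + m
    t≡1+m+m = m+[1+m+0]≡1+m+m m

  sumBinoms≡Σ : ∀ n m K → sumBinoms n m K ≡ Σ[ j < K ] ((2 * m) C (m ∸ suc j * n))
  sumBinoms≡Σ n m zero    = refl
  sumBinoms≡Σ n m (suc K) = cong (_+ (2 * m) C (m ∸ suc K * n)) (sumBinoms≡Σ n m K)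

  residueBinomSum : (M r e : ℕ) → ℕ
  residueBinomSum M r e = Σ[ x < suc r ] (𝟙 (M ∣? x + x + e) * (r C x))

  residueBinomSum-suc : ∀ M r e → residueBinomSum M (suc r) e ≡ residueBinomSum M r (e + 2) + residueBinomSum M r e
  residueBinomSum-suc M r e = begin
    Σ[ x < suc (suc r) ] φ (suc r) e x
      ≡⟨ Σ-suc (suc r) (φ (suc r) e) ⟩
    φ r e 0 + Σ[ x < suc r ] φ (suc r) e (suc x)
      ≡⟨ cong (φ r e 0 +_) (trans (Σ-cong (suc r) (λ x _ → pascal x)) (Σ-distrib-+ (suc r) (φ r (e + 2)) (φ r e ∘ suc))) ⟩
    φ r e 0 + (residueBinomSum M r (e + 2) + Σ[ x < suc r ] φ r e (suc x))
      ≡⟨ x∙yz≈y∙xz (φ r e 0) (residueBinomSum M r (e + 2)) _ ⟩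
    residueBinomSum M r (e + 2) + (φ r e 0 + Σ[ x < suc r ] φ r e (suc x))
      ≡⟨ cong (residueBinomSum M r (e + 2) +_) (Σ-suc (suc r) (φ r e)) ⟨
    residueBinomSum M r (e + 2) + (residueBinomSum M r e + φ r e (suc r))
      ≡⟨ cong (λ t → residueBinomSum M r (e + 2) + (residueBinomSum M r e + t)) φ-beyond ⟩
    residueBinomSum M r (e + 2) + (residueBinomSum M r e + 0)
      ≡⟨ cong (residueBinomSum M r (e + 2) +_) (+-identityʳ _) ⟩
    residueBinomSum M r (e + 2) + residueBinomSum M r e ∎
    where
    open ≡-Reasoning
    φ : ℕ → ℕ → ℕ → ℕ
    φ r e x = 𝟙 (M ∣? x + x + e) * (r C x)
    pascal : ∀ x → φ (suc r) e (suc x) ≡ φ r (e + 2) x + φ r e (suc x)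
    pascal x = begin
      𝟙 (M ∣? suc x + suc x + e) * (suc r C suc x)
        ≡⟨ cong (𝟙 (M ∣? suc x + suc x + e) *_) (nCk+nC[k+1]≡[n+1]C[k+1] r x) ⟨
      𝟙 (M ∣? suc x + suc x + e) * (r C x + r C suc x)
        ≡⟨ *-distribˡ-+ (𝟙 (M ∣? suc x + suc x + e)) (r C x) (r C suc x) ⟩
      𝟙 (M ∣? suc x + suc x + e) * (r C x) + φ r e (suc x)
        ≡⟨ cong (λ t → 𝟙 (M ∣? t) * (r C x) + φ r e (suc x)) (2+x+[1+x]+e≡x+x+[e+2] x e) ⟩
      φ r (e + 2) x + φ r e (suc x) ∎
      where
      2+x+[1+x]+e≡x+x+[e+2] : ∀ x e → suc x + suc x + e ≡ x + x + (e + 2)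
      2+x+[1+x]+e≡x+x+[e+2] = solve-∀
    φ-beyond : φ r e (suc r) ≡ 0
    φ-beyond = trans (cong (𝟙 (M ∣? suc r + suc r + e) *_) (k>n⇒nCk≡0 (n<1+n r))) (*-zeroʳ (𝟙 (M ∣? suc r + suc r + e)))

  residueBinomSum-2m : ∀ n .{{_ : NonZero n}} m e → 1 ≤ m → 2 * n ∣ m + m + e →
    residueBinomSum (2 * n) (2 * m) e ≡ 2 * ((2 * m ∸ 1) C (m ∸ 1) + sumBinoms n m (m / n))
  residueBinomSum-2m n m@(suc m′) e _ 2n∣2m+e = begin
    Σ[ x < suc (2 * m) ] φ x
      ≡⟨ Σ-around m φ ⟩
    φ m + Σ[ y < m ] (φ (m ∸ suc y) + φ (m + suc y))
      ≡⟨ cong₂ _+_ φ-centre (Σ-cong m (λ y y<m → cong₂ _+_ (φ-below y y<m) (φ-above y y<m))) ⟩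
    (2 * m) C m + Σ[ y < m ] (h y + h y)
      ≡⟨ cong₂ _+_ (centralBinomial m′) (Σ-distrib-+ m h h) ⟩
    2 * c + (Σ< m h + Σ< m h)
      ≡⟨ cong (λ s → 2 * c + (s + s)) Σh≡S ⟩
    2 * c + (S + S)
      ≡⟨ 2c+[s+s]≡2[c+s] c S ⟩
    2 * (c + S) ∎
    where
    open ≡-Reasoning
    c S : ℕ
    c = (2 * m ∸ 1) C m′
    S = sumBinoms n m (m / n)
    φ h : ℕ → ℕ
    φ x = 𝟙 (2 * n ∣? x + x + e) * ((2 * m) C x)
    h y = 𝟙 (n ∣? suc y) * ((2 * m) C (m ∸ suc y))

    φ-centre : φ m ≡ (2 * m) C m
    φ-centre = trans (cong (_* ((2 * m) C m)) (𝟙-yes (2 * n ∣? m + m + e) 2n∣2m+e)) (*-identityˡ _)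

    φ-above : ∀ y → y < m → φ (m + suc y) ≡ h y
    φ-above y y<m = cong₂ _*_
      (begin
        𝟙 (2 * n ∣? m + suc y + (m + suc y) + e)   ≡⟨ cong (λ t → 𝟙 (2 * n ∣? t)) (rearrange m (suc y) e) ⟩
        𝟙 (2 * n ∣? suc y + suc y + (m + m + e))   ≡⟨ 𝟙∣-+ (2 * n) (suc y + suc y) 2n∣2m+e ⟩
        𝟙 (2 * n ∣? suc y + suc y)                 ≡⟨ 𝟙∣-double n (suc y) ⟩
        𝟙 (n ∣? suc y)                             ∎)
      (trans (nCk≡nC[n∸k] m+1+y≤2m) (cong ((2 * m) C_) 2m∸[m+1+y]≡m∸[1+y]))
      where
      rearrange : ∀ m s e → m + s + (m + s) + e ≡ s + s + (m + m + e)
      rearrange = solve-∀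
      m+1+y≤2m : m + suc y ≤ 2 * m
      m+1+y≤2m = subst (m + suc y ≤_) (cong (m +_) (sym (+-identityʳ m))) (+-monoʳ-≤ m y<m)
      2m∸[m+1+y]≡m∸[1+y] : 2 * m ∸ (m + suc y) ≡ m ∸ suc y
      2m∸[m+1+y]≡m∸[1+y] = trans ([m+n]∸[m+o]≡n∸o m (m + 0) (suc y)) (cong (_∸ suc y) (+-identityʳ m))

    φ-below : ∀ y → y < m → φ (m ∸ suc y) ≡ h y
    φ-below y y<m = cong (_* ((2 * m) C (m ∸ suc y)))
      (trans (𝟙∣-complement (2 * n) (t + t + e) (suc y + suc y) (subst (2 * n ∣_) (sym sum≡2m+e) 2n∣2m+e))
             (𝟙∣-double n (suc y)))
      where
      t : ℕ
      t = m ∸ suc y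
      rearrange : ∀ t s e → t + t + e + (s + s) ≡ (t + s) + (t + s) + e
      rearrange = solve-∀
      sum≡2m+e : t + t + e + (suc y + suc y) ≡ m + m + e
      sum≡2m+e = trans (rearrange t (suc y) e) (cong (λ u → u + u + e) (m∸n+n≡m y<m))

    Σh≡S : Σ< m h ≡ S
    Σh≡S = trans (Σ-multiples n (λ j → (2 * m) C (m ∸ j)) m (m / n) (m/n*n≤m m n) (m<[1+m/n]*n m n))
                 (sym (sumBinoms≡Σ n m (m / n)))

    2c+[s+s]≡2[c+s] : ∀ c s → 2 * c + (s + s) ≡ 2 * (c + s)
    2c+[s+s]≡2[c+s] = solve-∀

  -- cyc r d counts the sequences s ∈ {±1}ʳ with N ∣ d + Σ s; adding w = N - 1 is a step -1.
  module CyclicWalks (w : ℕ) where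

    N : ℕ
    N = suc w

    cyc : ℕ → ℕ → ℕ
    cyc zero    d = 𝟙 (N ∣? d)
    cyc (suc r) d = cyc r (d + w) + cyc r (suc d)

    cyc-periodic : ∀ r d → cyc r (d + N) ≡ cyc r d
    cyc-periodic zero    d = 𝟙∣-+ N d ∣-refl
    cyc-periodic (suc r) d =
      cong₂ _+_ (trans (cong (cyc r) (xy∙z≈xz∙y d N w)) (cyc-periodic r (d + w))) (cyc-periodic r (suc d))

    cyc≡residueBinomSum : ∀ r d e → N ∣ e + r + d → cyc r d ≡ residueBinomSum N r e
    cyc≡residueBinomSum zero d e N∣e+0+d =
      trans (𝟙∣-complement N d e (subst (N ∣_) (e+0+d≡d+e e d) N∣e+0+d)) (sym (*-identityʳ _))
      where
      e+0+d≡d+e : ∀ e d → e + 0 + d ≡ d + e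
      e+0+d≡d+e = solve-∀
    cyc≡residueBinomSum (suc r) d e N∣e+[1+r]+d = begin
      cyc r (d + w) + cyc r (suc d)
        ≡⟨ cong₂ _+_ (cyc≡residueBinomSum r (d + w) (e + 2) (subst (N ∣_) (shift₁ e r d w) (∣m∣n⇒∣m+n N∣e+[1+r]+d ∣-refl)))
                     (cyc≡residueBinomSum r (suc d) e (subst (N ∣_) (shift₂ e r d) N∣e+[1+r]+d)) ⟩
      residueBinomSum N r (e + 2) + residueBinomSum N r e
        ≡⟨ residueBinomSum-suc N r e ⟨
      residueBinomSum N (suc r) e ∎
      where
      open ≡-Reasoning
      shift₁ : ∀ e r d w → e + suc r + d + suc w ≡ e + 2 + r + (d + w)
      shift₁ = solve-∀
      shift₂ : ∀ e r d → e + suc r + d ≡ e + r + suc d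
      shift₂ = solve-∀

  last-vertex-shift : ∀ k x y a → k ≡ suc x → x + a ≡ y + suc (suc (k + k)) →
                      a + suc (k + k) ≡ suc (suc x + suc y) + suc (suc (k + k))
  last-vertex-shift .(suc x) x y a refl x+a≡y+N =
    +-cancelˡ-≡ x _ _ (trans (sym (+-assoc x a _)) (trans (cong (_+ suc (suc x + suc x)) x+a≡y+N) (rearrange x y)))
    where
    rearrange : ∀ x y → y + suc (suc (suc x + suc x)) + suc (suc x + suc x)
                      ≡ x + (suc (suc x + suc y) + suc (suc (suc x + suc x)))
    rearrange = solve-∀

  module PathInCycle (k : ℕ) where

    w : ℕ
    w = suc (k + k)

    open CyclicWalks w public

    k<N : k < N
    k<N = s≤s (≤-trans (m≤m+n k k) (n≤1+n _))

    2+x+y<N : ∀ {x y} → x < k → y < k → suc x + suc y < N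
    2+x+y<N x<k y<k = s≤s (s≤s (+-mono-≤ (<⇒≤ x<k) y<k))

    x+a≡y+N⇒0<a : ∀ {x y a} → x < k → x + a ≡ y + N → 0 < a
    x+a≡y+N⇒0<a {a = suc _} _ _ = z<s
    x+a≡y+N⇒0<a {x} {y} {zero} x<k x+0≡y+N =
      contradiction (subst (N ≤_) (trans (sym x+0≡y+N) (+-identityʳ x)) (m≤n+m N y)) (<⇒≱ (<-trans x<k k<N))

    -- The path 0, …, k − 1 sits in the cycle of length N = 2k + 2 as the vertices 1, …, k, between the
    -- mirrors 0 and k + 1.  In reflection, cyc r a counts the cycle walks from y + 1 to x + 1 and
    -- cyc r (suc x + suc y) those from y + 1 to the mirror image −(x + 1); walks through a mirror cancel.
    reflection : ∀ r {x y a} → x < k → y < k → x + a ≡ y + N → walks k r x y + cyc r (suc x + suc y) ≡ cyc r a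
    reflection zero {x} {y} {a} x<k y<k x+a≡y+N = begin
      𝟙 (x ≟ y) + 𝟙 (N ∣? suc x + suc y) ≡⟨ cong (𝟙 (x ≟ y) +_) (𝟙-no (N ∣? suc x + suc y) (0<a<d⇒d∤a z<s (2+x+y<N x<k y<k))) ⟩
      𝟙 (x ≟ y) + 0                        ≡⟨ +-identityʳ _ ⟩
      𝟙 (x ≟ y)                            ≡⟨ 𝟙-cong (x ≟ y) (N ∣? a) x≡y⇒N∣a N∣a⇒x≡y ⟩
      𝟙 (N ∣? a)                           ∎
      where
      open ≡-Reasoning
      x≡y⇒N∣a : x ≡ y → N ∣ a
      x≡y⇒N∣a refl = subst (N ∣_) (sym (+-cancelˡ-≡ x a N x+a≡y+N)) ∣-refl
      a<N+N : a < N + N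
      a<N+N = ≤-<-trans (m≤n+m a x) (subst (_< N + N) (sym x+a≡y+N) (+-monoˡ-< N (<-trans y<k k<N)))
      N∣a⇒x≡y : N ∣ a → x ≡ y
      N∣a⇒x≡y N∣a = +-cancelʳ-≡ N x y (trans (cong (x +_) (sym (d∣a∧0<a<2d⇒a≡d N∣a (x+a≡y+N⇒0<a x<k x+a≡y+N) a<N+N))) x+a≡y+N)
    reflection (suc r) {a = zero} x<k _ x+0≡y+N = contradiction (x+a≡y+N⇒0<a x<k x+0≡y+N) (n≮n 0)
    reflection (suc r) {x} {y} {suc a} x<k y<k x+1+a≡y+N = begin
      (up + down) + (cyc r (suc x + suc y + w) + cyc r (suc (suc x + suc y)))
        ≡⟨ cong ((up + down) +_) (+-comm (cyc r (suc x + suc y + w)) _) ⟩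
      (up + down) + (cyc r (suc (suc x + suc y)) + cyc r (suc x + suc y + w))
        ≡⟨ interchange up down _ _ ⟩
      (up + cyc r (suc (suc x + suc y))) + (down + cyc r (suc x + suc y + w))
        ≡⟨ cong₂ _+_ (step-up (suc x <? k)) (step-down x x<k x+1+a≡y+N) ⟩
      cyc r (suc a + w) + cyc r (suc (suc a)) ∎
      where
      open ≡-Reasoning
      up down : ℕ
      up   = 𝟙 (suc x <? k) * walks k r (suc x) y
      down = 𝟙 (0 <? x) * walks k r (pred x) y

      step-up : (1+x<?k : Dec (suc x < k)) → 𝟙 1+x<?k * walks k r (suc x) y + cyc r (suc (suc x + suc y)) ≡ cyc r (suc a + w)
      step-up (yes 1+x<k) = begin
        1 * walks k r (suc x) y + cyc r (suc (suc x + suc y)) ≡⟨ cong (_+ cyc r (suc (suc x + suc y))) (*-identityˡ _) ⟩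
        walks k r (suc x) y + cyc r (suc (suc x + suc y))     ≡⟨ reflection r 1+x<k y<k (trans (sym (+-suc x a)) x+1+a≡y+N) ⟩
        cyc r a                                               ≡⟨ cyc-periodic r a ⟨
        cyc r (a + N)                                         ≡⟨ cong (cyc r) (+-suc a w) ⟩
        cyc r (suc a + w)                                     ∎
      -- x = k − 1: the cycle step onto the mirror k + 1 is its own mirror image, so the two cycle terms agree.
      step-up (no 1+x≮k) = begin
        0 * walks k r (suc x) y + cyc r (suc (suc x + suc y)) ≡⟨ cyc-periodic r _ ⟨
        cyc r (suc (suc x + suc y) + N)                       ≡⟨ cong (cyc r) (last-vertex-shift k x y (suc a) k≡1+x x+1+a≡y+N) ⟨
        cyc r (suc a + w)                                     ∎
        where
        k≡1+x : k ≡ suc x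
        k≡1+x = ≤-antisym (≮⇒≥ 1+x≮k) x<k

      step-down : ∀ x → x < k → x + suc a ≡ y + N → 𝟙 (0 <? x) * walks k r (pred x) y + cyc r (suc x + suc y + w) ≡ cyc r (suc (suc a))
      step-down zero    _   1+a≡y+N = cong (cyc r ∘ suc) (sym (trans 1+a≡y+N (+-suc y w)))
      step-down (suc x) x<k x+a≡y+N = begin
        1 * walks k r x y + cyc r (suc (suc x) + suc y + w)   ≡⟨ cong₂ _+_ (*-identityˡ _) (cong (cyc r) (sym (+-suc (suc x + suc y) w))) ⟩
        walks k r x y + cyc r (suc x + suc y + N)             ≡⟨ cong (walks k r x y +_) (cyc-periodic r _) ⟩
        walks k r x y + cyc r (suc x + suc y)                 ≡⟨ reflection r (<-trans (n<1+n x) x<k) y<k (trans (+-suc x (suc a)) x+a≡y+N) ⟩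
        cyc r (suc (suc a))                                   ∎

    closedWalks-reflection : ∀ r → Σ[ x < k ] walks k r x x + Σ[ x < k ] cyc r (suc x + suc x) ≡ k * cyc r 0
    closedWalks-reflection r = begin
      Σ[ x < k ] walks k r x x + Σ[ x < k ] cyc r (suc x + suc x)
        ≡⟨ Σ-distrib-+ k (λ x → walks k r x x) (λ x → cyc r (suc x + suc x)) ⟨
      Σ[ x < k ] (walks k r x x + cyc r (suc x + suc x))
        ≡⟨ Σ-cong k (λ x x<k → trans (reflection r x<k x<k refl) (cyc-periodic r 0)) ⟩
      Σ[ _ < k ] cyc r 0
        ≡⟨ Σ-const k (cyc r 0) ⟩
      k * cyc r 0 ∎
      where open ≡-Reasoning

    evens odds : ℕ → ℕ
    evens r = Σ[ x < suc k ] cyc r (x + x)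
    odds  r = Σ[ x < suc k ] cyc r (suc (x + x))

    evens-zero : evens 0 ≡ 1
    evens-zero = begin
      evens 0                                         ≡⟨ Σ-suc k (λ x → cyc 0 (x + x)) ⟩
      𝟙 (N ∣? 0) + Σ[ x < k ] 𝟙 (N ∣? suc x + suc x) ≡⟨ cong₂ _+_ (𝟙-yes (N ∣? 0) (N ∣0)) (Σ-cong k no-multiple) ⟩
      1 + Σ[ _ < k ] 0                                ≡⟨ cong suc (trans (Σ-const k 0) (*-zeroʳ k)) ⟩
      1                                               ∎
      where
      open ≡-Reasoning
      no-multiple : ∀ x → x < k → 𝟙 (N ∣? suc x + suc x) ≡ 0
      no-multiple x x<k = 𝟙-no (N ∣? suc x + suc x) (0<a<d⇒d∤a z<s (2+x+y<N x<k x<k))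

    evens-suc : ∀ r → evens (suc r) ≡ 2 * odds r
    evens-suc r = begin
      Σ[ x < suc k ] (cyc r (x + x + w) + cyc r (suc (x + x)))
        ≡⟨ Σ-distrib-+ (suc k) (λ x → cyc r (x + x + w)) (λ x → cyc r (suc (x + x))) ⟩
      Σ[ x < suc k ] cyc r (x + x + w) + odds r
        ≡⟨ cong (_+ odds r) (Σ-suc k (λ x → cyc r (x + x + w))) ⟩
      cyc r w + Σ[ x < k ] cyc r (suc x + suc x + w) + odds r
        ≡⟨ cong (λ s → cyc r w + s + odds r) (Σ-cong k (λ x _ → trans (cong (cyc r) (2+2x+w≡1+2x+N x k)) (cyc-periodic r _))) ⟩
      cyc r w + Σ[ x < k ] cyc r (suc (x + x)) + odds r
        ≡⟨ cong (_+ odds r) (+-comm (cyc r w) _) ⟩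
      odds r + odds r
        ≡⟨ cong (odds r +_) (+-identityʳ (odds r)) ⟨
      2 * odds r ∎
      where
      open ≡-Reasoning
      2+2x+w≡1+2x+N : ∀ x k → suc x + suc x + suc (k + k) ≡ suc (x + x) + suc (suc (k + k))
      2+2x+w≡1+2x+N = solve-∀

    odds-suc : ∀ r → odds (suc r) ≡ 2 * evens r
    odds-suc r = begin
      Σ[ x < suc k ] (cyc r (suc (x + x) + w) + cyc r (suc (suc (x + x))))
        ≡⟨ Σ-distrib-+ (suc k) (λ x → cyc r (suc (x + x) + w)) (λ x → cyc r (suc (suc (x + x)))) ⟩
      Σ[ x < suc k ] cyc r (suc (x + x) + w) + Σ[ x < suc k ] cyc r (suc (suc (x + x)))
        ≡⟨ cong₂ _+_ (Σ-cong (suc k) (λ x _ → trans (cong (cyc r) (sym (+-suc (x + x) w))) (cyc-periodic r (x + x))))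
                     (cong (_+ cyc r N) (Σ-cong k (λ x _ → cong (cyc r ∘ suc) (sym (+-suc x x))))) ⟩
      evens r + (Σ[ x < k ] cyc r (suc x + suc x) + cyc r (0 + N))
        ≡⟨ cong (λ t → evens r + (Σ[ x < k ] cyc r (suc x + suc x) + t)) (cyc-periodic r 0) ⟩
      evens r + (Σ[ x < k ] cyc r (suc x + suc x) + cyc r 0)
        ≡⟨ cong (evens r +_) (trans (+-comm _ (cyc r 0)) (sym (Σ-suc k (λ x → cyc r (x + x))))) ⟩
      evens r + evens r
        ≡⟨ cong (evens r +_) (+-identityʳ (evens r)) ⟨
      2 * evens r ∎
      where open ≡-Reasoning

    evens[2m]≡2^[2m] : ∀ m → evens (2 * m) ≡ 2 ^ (2 * m)
    evens[2m]≡2^[2m] zero = evens-zero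
    evens[2m]≡2^[2m] (suc m) = begin
      evens (2 * suc m)          ≡⟨ cong evens (*-suc 2 m) ⟩
      evens (2 + 2 * m)          ≡⟨ evens-suc (suc (2 * m)) ⟩
      2 * odds (suc (2 * m))     ≡⟨ cong (2 *_) (odds-suc (2 * m)) ⟩
      2 * (2 * evens (2 * m))    ≡⟨ cong (λ t → 2 * (2 * t)) (evens[2m]≡2^[2m] m) ⟩
      2 ^ (2 + 2 * m)            ≡⟨ cong (2 ^_) (*-suc 2 m) ⟨
      2 ^ (2 * suc m)            ∎
      where open ≡-Reasoning

    closedWalks+evens : ∀ r → closedWalks k r + evens r ≡ suc k * cyc r 0
    closedWalks+evens r = begin
      closedWalks k r + evens r
        ≡⟨ cong₂ _+_ (closedWalks≡Σwalks k r) (Σ-suc k (λ x → cyc r (x + x))) ⟩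
      Σ[ x < k ] walks k r x x + (cyc r 0 + Σ[ x < k ] cyc r (suc x + suc x))
        ≡⟨ x∙yz≈y∙xz (Σ[ x < k ] walks k r x x) (cyc r 0) _ ⟩
      cyc r 0 + (Σ[ x < k ] walks k r x x + Σ[ x < k ] cyc r (suc x + suc x))
        ≡⟨ cong (cyc r 0 +_) (closedWalks-reflection r) ⟩
      suc k * cyc r 0 ∎
      where open ≡-Reasoning

    cyc-2m-0 : ∀ m → 1 ≤ m → cyc (2 * m) 0 ≡ 2 * ((2 * m ∸ 1) C (m ∸ 1) + sumBinoms (suc k) m (m / suc k))
    cyc-2m-0 m 1≤m = begin
      cyc (2 * m) 0                          ≡⟨ cyc≡residueBinomSum (2 * m) 0 e (divides m (e+2m+0≡mN m k)) ⟩
      residueBinomSum N (2 * m) e            ≡⟨ cong (λ M → residueBinomSum M (2 * m) e) (N≡2[1+k] k) ⟩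
      residueBinomSum (2 * suc k) (2 * m) e  ≡⟨ residueBinomSum-2m (suc k) m e 1≤m (divides m (m+m+e≡m[2+2k] m k)) ⟩
      2 * ((2 * m ∸ 1) C (m ∸ 1) + sumBinoms (suc k) m (m / suc k)) ∎
      where
      open ≡-Reasoning
      e : ℕ
      e = m * (k + k)
      e+2m+0≡mN : ∀ m k → m * (k + k) + 2 * m + 0 ≡ m * suc (suc (k + k))
      e+2m+0≡mN = solve-∀
      N≡2[1+k] : ∀ k → suc (suc (k + k)) ≡ 2 * suc k
      N≡2[1+k] = solve-∀
      m+m+e≡m[2+2k] : ∀ m k → m + m + m * (k + k) ≡ m * (2 * suc k)
      m+m+e≡m[2+2k] = solve-∀

    closedWalks-formula : ∀ m → 1 ≤ m →
      closedWalks k (2 * m) + 2 ^ (2 * m) ≡ 2 * suc k * ((2 * m ∸ 1) C (m ∸ 1) + sumBinoms (suc k) m (m / suc k))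
    closedWalks-formula m 1≤m = begin
      closedWalks k (2 * m) + 2 ^ (2 * m)    ≡⟨ cong (closedWalks k (2 * m) +_) (evens[2m]≡2^[2m] m) ⟨
      closedWalks k (2 * m) + evens (2 * m)  ≡⟨ closedWalks+evens (2 * m) ⟩
      suc k * cyc (2 * m) 0                  ≡⟨ cong (suc k *_) (cyc-2m-0 m 1≤m) ⟩
      suc k * (2 * X)                        ≡⟨ *-assoc (suc k) 2 X ⟨
      suc k * 2 * X                          ≡⟨ cong (_* X) (*-comm (suc k) 2) ⟩
      2 * suc k * X                          ∎
      where
      open ≡-Reasoning
      X : ℕ
      X = (2 * m ∸ 1) C (m ∸ 1) + sumBinoms (suc k) m (m / suc k)

  m+n≡o⇒+m≡+o-+n : ∀ {m n o} → m + n ≡ o → ℤ.+ m ≡ ℤ.+ o ℤ.- ℤ.+ n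
  m+n≡o⇒+m≡+o-+n {m} {n} refl =
    sym (trans ([+m]-[+n]≡m⊖n (m + n) n) (trans (⊖-≥ (m≤n+m n m)) (cong ℤ.+_ (m+n∸n≡m m n))))

open import Defs
open import Data.Nat using (ℕ; zero; suc; _≤_; _<_; _∸_; _/_; _^_) renaming (_*_ to _*ℕ_; _+_ to _+ℕ_)
open import Data.Nat.Combinatorics using (_C_)
open import Data.Nat.DivMod using (m<n⇒m/n≡0)
open import Data.Integer using (ℤ; +_; _-_; _*_; _+_)
open import Data.Integer.Properties using (pos-*; pos-+; +-identityʳ)
open import Data.Product using (_×_; _,_)
open import Relation.Binary.PropositionalEquality using (_≡_; cong; trans)
open ClosedWalkCount using (m+n≡o⇒+m≡+o-+n)
open ClosedWalkCount.PathInCycle using (closedWalks-formula)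

theorem5p1 : (n m : ℕ) (h : 2 ≤ n) → 1 ≤ m →
    (n ≤ m → + closedWalks (n ∸ 1) (2 Data.Nat.* m)
      ≡ (+ (2 Data.Nat.* n)) * (+ ((2 Data.Nat.* m ∸ 1) C (m ∸ 1)) + + sumBinoms n m (_/_ m n {{≥2⇒nonZero h}})) - + (2 ^ (2 Data.Nat.* m)))
    × (m < n → + closedWalks (n ∸ 1) (2 Data.Nat.* m)
      ≡ (+ (2 Data.Nat.* n)) * + ((2 Data.Nat.* m ∸ 1) C (m ∸ 1)) - + (2 ^ (2 Data.Nat.* m)))
theorem5p1 zero    _ () _
theorem5p1 (suc k) m _  1≤m =
  (λ _ → formula) , λ m<n → trans formula (cong (λ s → + (2 *ℕ suc k) * s - + (2 ^ (2 *ℕ m))) (no-multiples m<n))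
  where
  c S : ℕ
  c = (2 *ℕ m ∸ 1) C (m ∸ 1)
  S = sumBinoms (suc k) m (m / suc k)
  formula : + closedWalks k (2 *ℕ m) ≡ + (2 *ℕ suc k) * (+ c + + S) - + (2 ^ (2 *ℕ m))
  formula = trans (m+n≡o⇒+m≡+o-+n (closedWalks-formula k m 1≤m))
                  (cong (_- + (2 ^ (2 *ℕ m))) (trans (pos-* (2 *ℕ suc k) (c +ℕ S)) (cong (+ (2 *ℕ suc k) *_) (pos-+ c S))))
  no-multiples : m < suc k → + c + + S ≡ + c
  no-multiples m<n = trans (cong (λ q → + c + + sumBinoms (suc k) m q) (m<n⇒m/n≡0 m<n)) (+-identityʳ (+ c))
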